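{- Let $S$ be a solid and let $x,y,z\in S$. If $y$ and $z$ are of the same sign (both positive or both negative), then $x(y+z)=xy+xz$.
   Context: A solid is a set $S$ with binary operations $+$ and $\cdot$ and a relation $\le$ satisfying: (1) $+$ is associative and commutative; for every $x$ there is a unique $e$ with $x+e=x$ and $e+f=e$ whenever $x+f=x$, written $e(x)$ (the magnitude of $x$); for every $x$ there is $s$ with $x+s=e(x)$ and $e(s)=e(x)$, written $-x$; $e(x+y)=e(x)$ or $e(x+y)=e(y)$. (2) $\cdot$ is associative and commutative; for every $x\ne e(x)$ there is a unique $u$ with $xu=x$ and $uv=u$ whenever $xv=x$, written $u(x)$; for every $x\ne e(x)$ there is $d$ with $xd=u(x)$ and $u(d)=u(x)$, written $x^{ -1}$; for $x\ne e(x),y\ne e(y)$: $u(xy)=u(x)$ or $u(xy)=u(y)$. (3) $\le$ is a total order; $x\le y\Rightarrow x+z\le y+z$; $y+e(x)=e(x)\Rightarrow (y\le e(x)$ and $-y\le e(x))$; $(e(x)<x$ and $y\le z)\Rightarrow xy\le xz$; $e(y)\le y\le z\Rightarrow e(x)y\le e(x)z$. (4) For all $x,y$ there is $z$ with $e(x)y=e(z)$; $e(xy)=e(x)y+e(y)x$; for $x\ne e(x)$, $e(u(x))=e(x)x^{ -1}$; $xy+xz=x(y+z)+e(x)y+e(x)z$; $-(xy)=(-x)y$. (5) There is $0$ with $0+x=x$ for all $x$; there is $1$ with $1x=x$ for all $x$; there is $M$ with $e(x)+M=M$ for all $x$; there is $x$ with $e(x)\ne 0$ and $e(x)\ne M$;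 for every $x$ there is $a$ with $x=a+e(x)$ and $e(a)=0$; if $x=e(x)$, $y=e(y)$ and $x<y$ then there is $z\ne e(z)$ with $x<z<y$. An element $x$ is positive if $e(x)\le x$ and negative if $x<e(x)$. -}

module Defs where

open import Level using (Level; _⊔_; suc)
open import Data.Product using (Σ; _×_; _,_)
open import Data.Sum using (_⊎_)
open import Relation.Binary.PropositionalEquality using (_≡_; _≢_)

-- The uniquely determined e(x), u(x) and the chosen -x, x⁻¹ are given as
-- functions together with their defining properties (u and ⁻¹ are only
-- constrained on elements x with x ≢ e x, as in the paper).
record Solid (a ℓ : Level) : Set (suc (a ⊔ ℓ)) where
  infixl 6 _+_
  infixl 7 _*_
  infix 4 _≤_ _<_
  field
    Carrier : Set a
    _+_     : Carrier → Carrier → Carrier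
    _*_     : Carrier → Carrier → Carrier
    _≤_     : Carrier → Carrier → Set ℓ
    e       : Carrier → Carrier
    -_      : Carrier → Carrier
    u       : Carrier → Carrier
    _⁻¹     : Carrier → Carrier

  _<_ : Carrier → Carrier → Set (a ⊔ ℓ)
  x < y = (x ≤ y) × (x ≢ y)

  field
    -- (1)
    +-assoc   : ∀ x y z → (x + y) + z ≡ x + (y + z)
    +-comm    : ∀ x y → x + y ≡ y + x
    e-neutral : ∀ x → x + e x ≡ x
    e-least   : ∀ x f → x + f ≡ x → e x + f ≡ e x
    e-unique  : ∀ x e′ → x + e′ ≡ x → (∀ f → x + f ≡ x → e′ + f ≡ e′) → e′ ≡ e x
    neg-inv   : ∀ x → x + (- x) ≡ e x
    neg-e     : ∀ x → e (- x) ≡ e x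
    e-+       : ∀ x y → (e (x + y) ≡ e x) ⊎ (e (x + y) ≡ e y)
    -- (2)
    *-assoc   : ∀ x y z → (x * y) * z ≡ x * (y * z)
    *-comm    : ∀ x y → x * y ≡ y * x
    u-neutral : ∀ x → x ≢ e x → x * u x ≡ x
    u-least   : ∀ x v → x ≢ e x → x * v ≡ x → u x * v ≡ u x
    u-unique  : ∀ x u′ → x ≢ e x → x * u′ ≡ x → (∀ v → x * v ≡ x → u′ * v ≡ u′) → u′ ≡ u x
    inv-inv   : ∀ x → x ≢ e x → x * (x ⁻¹) ≡ u x
    inv-u     : ∀ x → x ≢ e x → u (x ⁻¹) ≡ u x
    u-*       : ∀ x y → x ≢ e x → y ≢ e y → (u (x * y) ≡ u x) ⊎ (u (x * y) ≡ u y)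
    -- (3)
    ≤-refl    : ∀ x → x ≤ x
    ≤-trans   : ∀ {x y z} → x ≤ y → y ≤ z → x ≤ z
    ≤-antisym : ∀ {x y} → x ≤ y → y ≤ x → x ≡ y
    ≤-total   : ∀ x y → (x ≤ y) ⊎ (y ≤ x)
    +-mono-≤  : ∀ {x y} z → x ≤ y → x + z ≤ y + z
    absorbed-≤ : ∀ x y → y + e x ≡ e x → (y ≤ e x) × (- y ≤ e x)
    *-mono-≤  : ∀ {x y z} → e x < x → y ≤ z → x * y ≤ x * z
    e*-mono-≤ : ∀ {x y z} → e y ≤ y → y ≤ z → e x * y ≤ e x * z
    -- (4)
    e*-is-e   : ∀ x y → Σ Carrier (λ z → e x * y ≡ e z)
    e-*       : ∀ x y → e (x * y) ≡ e x * y + e y * x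
    e-u       : ∀ x → x ≢ e x → e (u x) ≡ e x * (x ⁻¹)
    distrib   : ∀ x y z → x * y + x * z ≡ x * (y + z) + e x * y + e x * z
    neg-*     : ∀ x y → - (x * y) ≡ (- x) * y
    -- (5)
    0#        : Carrier
    +-identityˡ : ∀ x → 0# + x ≡ x
    1#        : Carrier
    *-identityˡ : ∀ x → 1# * x ≡ x
    M         : Carrier
    M-absorbs : ∀ x → e x + M ≡ M
    nontrivial : Σ Carrier (λ x → (e x ≢ 0#) × (e x ≢ M))
    decompose : ∀ x → Σ Carrier (λ a → (x ≡ a + e x) × (e a ≡ 0#))
    dense     : ∀ x y → x ≡ e x → y ≡ e y → x < y →
                Σ Carrier (λ z → (z ≢ e z) × (x < z) × (z < y))

  Positive : Carrier → Set ℓ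
  Positive x = e x ≤ x

  Negative : Carrier → Set (a ⊔ ℓ)
  Negative x = x < e x

-- Axiom (4) gives x y + x z = x (y + z) + e(x) y + e(x) z, so it suffices that
-- x (y + z) absorbs e(x) y and e(x) z, hence that its magnitude
-- e(x) (y + z) + e(y + z) x does.  Among magnitudes the larger absorbs the
-- smaller, and all of e(x) w are magnitudes; for y, z positive
-- e(x) y ≤ e(x) (y + z) by monotonicity, and the negative case reduces to the
-- positive one because e(x) (- w) = e(x) w.
module Submission where

open import Defs
open import Level using (_⊔_)
open import Function using (_∘_)
open import Data.Product using (_×_; _,_; proj₁)
open import Data.Sum using (_⊎_; inj₁; inj₂)
open import Relation.Binary.PropositionalEquality
  using (_≡_; refl; sym; trans; cong; cong₂; subst; subst₂; isEquivalence)
open import Algebra.Bundles using (CommutativeSemigroup)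
import Algebra.Properties.CommutativeSemigroup as CommutativeSemigroupProperties

module SolidProperties {a ℓ} (S : Solid a ℓ) where
  open Solid S
  open Relation.Binary.PropositionalEquality.≡-Reasoning

  +-commutativeSemigroup : CommutativeSemigroup a a
  +-commutativeSemigroup = record
    { Carrier = Carrier
    ; _≈_ = _≡_
    ; _∙_ = _+_
    ; isCommutativeSemigroup = record
      { isSemigroup = record
        { isMagma = record { isEquivalence = isEquivalence ; ∙-cong = cong₂ _+_ }
        ; assoc = +-assoc
        }
      ; comm = +-comm
      }
    }

  open CommutativeSemigroupProperties +-commutativeSemigroup
    using (interchange; xy∙z≈xz∙y)

  IsMagnitude : Carrier → Set a
  IsMagnitude w = e w ≡ w

  Absorbs : Carrier → Carrier → Set a
  Absorbs P A = P + A ≡ P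

  SameSign : Carrier → Carrier → Set (a ⊔ ℓ)
  SameSign y z = (Positive y × Positive z) ⊎ (Negative y × Negative z)

  sameSign-comm : ∀ {y z} → SameSign y z → SameSign z y
  sameSign-comm (inj₁ (py , pz)) = inj₁ (pz , py)
  sameSign-comm (inj₂ (ny , nz)) = inj₂ (nz , ny)

  e-idem : ∀ w → e w + e w ≡ e w
  e-idem w = e-least w (e w) (e-neutral w)

  e-isMagnitude : ∀ w → IsMagnitude (e w)
  e-isMagnitude w = sym (e-unique (e w) (e w) (e-idem w) (λ _ absorbed → absorbed))

  e-distrib-+-when-left : ∀ p q → e (p + q) ≡ e p → e (p + q) ≡ e p + e q
  e-distrib-+-when-left p q e[p+q]≡ep = begin
    e (p + q)               ≡⟨ sym absorbs ⟩
    e (p + q) + (e p + e q) ≡⟨ cong (_+ (e p + e q)) e[p+q]≡ep ⟩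
    e p + (e p + e q)       ≡⟨ sym (+-assoc (e p) (e p) (e q)) ⟩
    (e p + e p) + e q       ≡⟨ cong (_+ e q) (e-idem p) ⟩
    e p + e q               ∎
    where
    absorbs : e (p + q) + (e p + e q) ≡ e (p + q)
    absorbs = e-least (p + q) (e p + e q)
      (trans (interchange p q (e p) (e q)) (cong₂ _+_ (e-neutral p) (e-neutral q)))

  e-distrib-+ : ∀ p q → e (p + q) ≡ e p + e q
  e-distrib-+ p q with e-+ p q
  ... | inj₁ e[p+q]≡ep = e-distrib-+-when-left p q e[p+q]≡ep
  ... | inj₂ e[p+q]≡eq = begin
    e (p + q) ≡⟨ cong e (+-comm p q) ⟩
    e (q + p) ≡⟨ e-distrib-+-when-left q p (trans (cong e (+-comm q p)) e[p+q]≡eq) ⟩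
    e q + e p ≡⟨ +-comm (e q) (e p) ⟩
    e p + e q ∎

  neg-unique : ∀ x s → x + s ≡ e x → e s ≡ e x → s ≡ - x
  neg-unique x s x+s≡ex es≡ex = begin
    s             ≡⟨ sym (e-neutral s) ⟩
    s + e s       ≡⟨ cong (s +_) (trans es≡ex (sym (neg-inv x))) ⟩
    s + (x + - x) ≡⟨ sym (+-assoc s x (- x)) ⟩
    (s + x) + - x ≡⟨ cong (_+ - x) (trans (+-comm s x) x+s≡ex) ⟩
    e x + - x     ≡⟨ cong (_+ - x) (sym (neg-e x)) ⟩
    e (- x) + - x ≡⟨ +-comm (e (- x)) (- x) ⟩
    - x + e (- x) ≡⟨ e-neutral (- x) ⟩
    - x           ∎

  neg-distrib-+ : ∀ p q → - (p + q) ≡ - p + - q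
  neg-distrib-+ p q = sym (neg-unique (p + q) (- p + - q) sum-inverse magnitudes-agree)
    where
    sum-inverse : (p + q) + (- p + - q) ≡ e (p + q)
    sum-inverse = begin
      (p + q) + (- p + - q) ≡⟨ interchange p q (- p) (- q) ⟩
      (p + - p) + (q + - q) ≡⟨ cong₂ _+_ (neg-inv p) (neg-inv q) ⟩
      e p + e q             ≡⟨ sym (e-distrib-+ p q) ⟩
      e (p + q)             ∎
    magnitudes-agree : e (- p + - q) ≡ e (p + q)
    magnitudes-agree = begin
      e (- p + - q)     ≡⟨ e-distrib-+ (- p) (- q) ⟩
      e (- p) + e (- q) ≡⟨ cong₂ _+_ (neg-e p) (neg-e q) ⟩
      e p + e q         ≡⟨ sym (e-distrib-+ p q) ⟩
      e (p + q)         ∎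

  neg-magnitude : ∀ C → IsMagnitude C → - C ≡ C
  neg-magnitude C eC≡C = sym (neg-unique C C C+C≡eC refl)
    where
    C+C≡eC : C + C ≡ e C
    C+C≡eC = trans (subst (λ w → w + w ≡ w) eC≡C (e-idem C)) (sym eC≡C)

  e*-isMagnitude : ∀ x w → IsMagnitude (e x * w)
  e*-isMagnitude x w with e*-is-e x w
  ... | (z , ex*w≡ez) = trans (cong e ex*w≡ez) (trans (e-isMagnitude z) (sym ex*w≡ez))

  e*-neg : ∀ x w → e x * (- w) ≡ e x * w
  e*-neg x w = begin
    e x * (- w) ≡⟨ *-comm (e x) (- w) ⟩
    (- w) * e x ≡⟨ sym (neg-* w (e x)) ⟩
    - (w * e x) ≡⟨ cong -_ (*-comm w (e x)) ⟩
    - (e x * w) ≡⟨ neg-magnitude (e x * w) (e*-isMagnitude x w) ⟩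
    e x * w     ∎

  magnitude-absorbs-≤ : ∀ {A C} → IsMagnitude A → IsMagnitude C → A ≤ C → Absorbs C A
  magnitude-absorbs-≤ {A} {C} eA≡A eC≡C A≤C =
    trans (+-comm C A) (A+C≡C (e-+ A C))
    where
    A+C-isMagnitude : e (A + C) ≡ A + C
    A+C-isMagnitude = trans (e-distrib-+ A C) (cong₂ _+_ eA≡A eC≡C)
    A+C≡C : (e (A + C) ≡ e A) ⊎ (e (A + C) ≡ e C) → A + C ≡ C
    A+C≡C (inj₂ e[A+C]≡eC) = trans (sym A+C-isMagnitude) (trans e[A+C]≡eC eC≡C)
    -- If A + C collapses to A, then C is absorbed by e A = A, so axiom (3) gives C ≤ A.
    A+C≡C (inj₁ e[A+C]≡eA) = trans A+C≡A (≤-antisym A≤C C≤A)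
      where
      A+C≡A : A + C ≡ A
      A+C≡A = trans (sym A+C-isMagnitude) (trans e[A+C]≡eA eA≡A)
      C≤A : C ≤ A
      C≤A = subst (C ≤_) eA≡A (proj₁ (absorbed-≤ A C
              (trans (cong (C +_) eA≡A) (trans (+-comm C A) (trans A+C≡A (sym eA≡A))))))

  positive-≤-+ : ∀ {y z} → Positive y → Positive z → y ≤ y + z
  positive-≤-+ {y} {z} _ ez≤z = subst₂ _≤_ (+-identityˡ y) (+-comm z y)
    (≤-trans (+-mono-≤ y 0≤ez) (+-mono-≤ y ez≤z))
    where
    0≤ez : 0# ≤ e z
    0≤ez = proj₁ (absorbed-≤ z 0# (+-identityˡ (e z)))

  negative⇒neg-positive : ∀ {y} → Negative y → Positive (- y)
  negative⇒neg-positive {y} (y≤ey , _) = subst₂ _≤_ y-y≡e[-y] ey-y≡-y (+-mono-≤ (- y) y≤ey)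
    where
    y-y≡e[-y] : y + - y ≡ e (- y)
    y-y≡e[-y] = trans (neg-inv y) (sym (neg-e y))
    ey-y≡-y : e y + - y ≡ - y
    ey-y≡-y = trans (cong (_+ - y) (sym (neg-e y))) (trans (+-comm _ _) (e-neutral (- y)))

  e*-absorbs-summand : ∀ x {y z} → SameSign y z → Absorbs (e x * (y + z)) (e x * y)
  e*-absorbs-summand x {y} {z} (inj₁ (py , pz)) =
    magnitude-absorbs-≤ (e*-isMagnitude x y) (e*-isMagnitude x (y + z))
      (e*-mono-≤ py (positive-≤-+ py pz))
  e*-absorbs-summand x {y} {z} (inj₂ (ny , nz)) =
    subst₂ Absorbs ex*[-y-z]≡ex*[y+z] (e*-neg x y)
      (e*-absorbs-summand x (inj₁ (negative⇒neg-positive ny , negative⇒neg-positive nz)))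
    where
    ex*[-y-z]≡ex*[y+z] : e x * (- y + - z) ≡ e x * (y + z)
    ex*[-y-z]≡ex*[y+z] = trans (cong (e x *_) (sym (neg-distrib-+ y z))) (e*-neg x (y + z))

  absorbs-from-magnitude : ∀ {P A} → Absorbs (e P) A → Absorbs P A
  absorbs-from-magnitude {P} {A} eP+A≡eP = begin
    P + A         ≡⟨ cong (_+ A) (sym (e-neutral P)) ⟩
    (P + e P) + A ≡⟨ +-assoc P (e P) A ⟩
    P + (e P + A) ≡⟨ cong (P +_) eP+A≡eP ⟩
    P + e P       ≡⟨ e-neutral P ⟩
    P             ∎

  e*-absorbs⇒e-*-absorbs : ∀ {x w A} → Absorbs (e x * w) A → Absorbs (e (x * w)) A
  e*-absorbs⇒e-*-absorbs {x} {w} {A} ex*w+A≡ex*w = begin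
    e (x * w) + A           ≡⟨ cong (_+ A) (e-* x w) ⟩
    (e x * w + e w * x) + A ≡⟨ xy∙z≈xz∙y (e x * w) (e w * x) A ⟩
    (e x * w + A) + e w * x ≡⟨ cong (_+ e w * x) ex*w+A≡ex*w ⟩
    e x * w + e w * x       ≡⟨ sym (e-* x w) ⟩
    e (x * w)               ∎

  distrib-sameSign : ∀ x {y z} → SameSign y z → x * (y + z) ≡ x * y + x * z
  distrib-sameSign x {y} {z} y~z = sym (begin
    x * y + x * z                     ≡⟨ distrib x y z ⟩
    (x * (y + z) + e x * y) + e x * z ≡⟨ cong (_+ e x * z) (absorbs y-absorbed) ⟩
    x * (y + z) + e x * z             ≡⟨ absorbs z-absorbed ⟩
    x * (y + z)                       ∎)
    where
    absorbs : ∀ {A} → Absorbs (e x * (y + z)) A → Absorbs (x * (y + z)) A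
    absorbs = absorbs-from-magnitude ∘ e*-absorbs⇒e-*-absorbs
    y-absorbed : Absorbs (e x * (y + z)) (e x * y)
    y-absorbed = e*-absorbs-summand x y~z
    z-absorbed : Absorbs (e x * (y + z)) (e x * z)
    z-absorbed = subst (λ t → Absorbs (e x * t) (e x * z)) (+-comm z y)
                   (e*-absorbs-summand x (sameSign-comm y~z))

corollary4p4 : ∀ {a ℓ} (S : Solid a ℓ) → let open Solid S in
               ∀ (x y z : Carrier) →
               (Positive y × Positive z) ⊎ (Negative y × Negative z) →
               x * (y + z) ≡ x * y + x * z
corollary4p4 S x y z = SolidProperties.distrib-sameSign S x
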